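{- For a gehm $\mathbb{H}$, $T(\mathbb{H}^*;x,y)=T(\mathbb{H};y,x)$.
   Context: A gehm is a finite cubic graph whose edges are properly coloured with colours $b,g,r$, together with possibly some isolates ($g$-coloured edges meeting no vertex). The dual $\mathbb{H}^*$ is obtained by interchanging colours $b$ and $r$ on all gehm-edges. Hyperedges are $b$--$r$-cycles, hyperfaces are $b$--$g$-cycles or isolates, hypervertices are $g$--$r$-cycles or isolates. $E(\mathbb{H})$, $e(\mathbb{H})$, $v(\mathbb{H})$, $f(\mathbb{H})$: set of hyperedges and numbers of hyperedges, hypervertices, hyperfaces; $k(\mathbb{H})$: number of components (isolates count); $d(e)$: half the number of gehm-edges in hyperedge $e$, $d(A)=\sum_{e\in A}d(e)$, $d(\mathbb{H})=d(E(\mathbb{H}))$; $\gamma(\mathbb{H})=2k(\mathbb{H})-v(\mathbb{H})-e(\mathbb{H})+d(\mathbb{H})-f(\mathbb{H})$. Suppressing a degree-two vertex: if its only edge is a loop, replace it and the loop by an isolate; otherwise contract one incident edge. Deleting a hyperedge $e$: delete its $b$-edges, contract its $r$-edges, suppress degree-two vertices. For $A\subseteq E(\mathbb{H})$, $\mathbb{H}_{|A}$ is obtained by deleting all hyperedges not in $A$; $v(A),k(A),f(A),\gamma(A)$ are the quantities of $\mathbb{H}_{|A}$. $\rho(\mathbb{H})=v(\mathbb{H})-k(\mathbb{H})+\tfrac12\gamma(\mathbb{H})$, $\rho(A)=v(A)-k(A)+\tfrac12\gamma(A)$. $T(\mathbb{H};x,y)=\sum_{A\subseteq E(\mathbb{H})}(x-1)^{\rho(\mathbb{H})-\rho(A)}(y-1)^{d(A)-|A|-\rho(A)}$.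 -}

module Defs where

open import Data.Nat as ℕ using (ℕ; zero; suc; ⌊_/2⌋; _≤ᵇ_)
open import Data.Bool using (Bool; true; false; _∧_; _∨_; not; if_then_else_)
import Data.Bool as Bool
open import Data.Fin as Fin using (Fin; toℕ)
open import Data.List using (List; []; _∷_; allFin; concatMap)
open import Data.Bool.ListAction using (all; any)
open import Data.Integer as ℤ using (ℤ; +_; _-_)
open import Relation.Nullary using (¬_; does)
open import Relation.Binary.PropositionalEquality using (_≡_)

-- A gehm: a finite cubic graph on vertex set Fin n whose edges are
-- properly coloured b, g, r.  A proper 3-edge-colouring of a cubic
-- (multi)graph is the same as three perfect matchings, i.e. three
-- fixed-point-free involutions b, g, r on the vertices (v's c-coloured
-- edge goes to c v).  Parallel edges of distinct colours are allowed.

record Gehm : Set where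
  field
    n        : ℕ
    b g r    : Fin n → Fin n
    b-invol  : ∀ v → b (b v) ≡ v
    g-invol  : ∀ v → g (g v) ≡ v
    r-invol  : ∀ v → r (r v) ≡ v
    b-fpf    : ∀ v → ¬ (b v ≡ v)
    g-fpf    : ∀ v → ¬ (g v ≡ v)
    r-fpf    : ∀ v → ¬ (r v ≡ v)
    isolates : ℕ

dual : Gehm → Gehm
dual H = record
  { n = n ; b = r ; g = g ; r = b
  ; b-invol = r-invol ; g-invol = g-invol ; r-invol = b-invol
  ; b-fpf = r-fpf ; g-fpf = g-fpf ; r-fpf = b-fpf
  ; isolates = isolates }
  where open Gehm H

count : ∀ {A : Set} → (A → Bool) → List A → ℕ
count p []       = 0
count p (x ∷ xs) = if p x then suc (count p xs) else count p xs

reach : ∀ {n} → List (Fin n → Fin n) → ℕ → Fin n → Fin n → Bool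
reach fs zero    v w = does (v Fin.≟ w)
reach fs (suc k) v w = reach fs k v w ∨ any (λ f → reach fs k (f v) w) fs

connected : ∀ {n} → List (Fin n → Fin n) → Fin n → Fin n → Bool
connected {n} fs v w = reach fs n v w

isRep : ∀ {n} → (Fin n → Bool) → List (Fin n → Fin n) → Fin n → Bool
isRep {n} mask fs v =
  mask v ∧ all (λ w → not (mask w ∧ connected fs v w) ∨ (toℕ v ≤ᵇ toℕ w)) (allFin n)

classes : ∀ {n} → (Fin n → Bool) → List (Fin n → Fin n) → ℕ
classes {n} mask fs = count (isRep mask fs) (allFin n)

-- "Pre-gehm": coloured structure on the vertices of a subset `mask` of
-- Fin n (used to describe H itself and the gehms H_{|A}).

record PreGehm (n : ℕ) : Set where
  field
    mask  : Fin n → Bool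
    b g r : Fin n → Fin n
    iso   : ℕ

module Quantities {n : ℕ} (P : PreGehm n) where
  open PreGehm P
  vQ : ℕ
  vQ = classes mask (g ∷ r ∷ []) ℕ.+ iso
  fQ : ℕ
  fQ = classes mask (b ∷ g ∷ []) ℕ.+ iso
  eQ : ℕ
  eQ = classes mask (b ∷ r ∷ []) ℕ.+ 0
  kQ : ℕ
  kQ = classes mask (b ∷ g ∷ r ∷ []) ℕ.+ iso
  -- d = sum over hyperedges of half their number of gehm-edges;
  -- a b–r cycle through m vertices has m gehm-edges, so d = #vertices / 2
  dQ : ℕ
  dQ = ⌊ count mask (allFin n) /2⌋
  γQ : ℤ
  γQ = (+ (2 ℕ.* kQ)) - + vQ - + eQ ℤ.+ + dQ - + fQ
  twoρQ : ℤ
  twoρQ = + (2 ℕ.* vQ) - + (2 ℕ.* kQ) ℤ.+ γQ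

module _ (H : Gehm) where
  open Gehm H

  full : PreGehm n
  full = record { mask = λ _ → true ; b = b ; g = g ; r = r ; iso = isolates }

  -- A set of hyperedges A ⊆ E(H) is represented by the set of vertices
  -- lying on its hyperedges: a vertex set closed under b and r.
  closed : (Fin n → Bool) → Bool
  closed A = all (λ v → does (A v Bool.≟ A (b v)) ∧ does (A v Bool.≟ A (r v))) (allFin n)

  -- Deleting all hyperedges outside A (vertex set Fin n minus A):
  -- b-edges of deleted hyperedges are removed, their r-edges contracted
  -- and degree-two vertices suppressed.  The surviving vertices are
  -- those of A, keeping b and r; a surviving vertex w gets as g-neighbour
  -- the end of the g,r,g,r,...,g path leaving w through deleted vertices
  -- (the chain of suppressed vertices); each g–r cycle consisting
  -- entirely of deleted vertices collapses to one isolate.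
  exitA : (Fin n → Bool) → ℕ → Fin n → Fin n
  exitA A zero    u = u
  exitA A (suc k) u = if A u then u else exitA A k (g (r u))

  gA : (Fin n → Bool) → Fin n → Fin n
  gA A w = exitA A n (g w)

  newIsolates : (Fin n → Bool) → ℕ
  newIsolates A =
    count (λ v → isRep (λ _ → true) (g ∷ r ∷ []) v
                 ∧ all (λ w → not (connected (g ∷ r ∷ []) v w) ∨ not (A w)) (allFin n))
          (allFin n)

  restrict : (Fin n → Bool) → PreGehm n
  restrict A = record { mask = A ; b = b ; g = gA A ; r = r
                      ; iso = isolates ℕ.+ newIsolates A }

  twoρH : ℤ
  twoρH = Quantities.twoρQ full

  twoρA : (Fin n → Bool) → ℤ
  twoρA A = Quantities.twoρQ (restrict A)

  cardA : (Fin n → Bool) → ℕ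
  cardA A = classes A (b ∷ r ∷ [])

  dA : (Fin n → Bool) → ℕ
  dA A = ⌊ count A (allFin n) /2⌋

  -- doubled exponents of (x-1) and (y-1) in the term of A
  expX2 : (Fin n → Bool) → ℤ
  expX2 A = twoρH - twoρA A

  expY2 : (Fin n → Bool) → ℤ
  expY2 A = (+ (2 ℕ.* dA A)) - + (2 ℕ.* cardA A) - twoρA A

allSubsets : ∀ n → List (Fin n → Bool)
allSubsets zero    = (λ ()) ∷ []
allSubsets (suc n) =
  concatMap (λ S → (λ { Fin.zero → false ; (Fin.suc i) → S i })
                 ∷ (λ { Fin.zero → true ; (Fin.suc i) → S i }) ∷ [])
            (allSubsets n)

-- Coefficient of (x-1)^(i/2) (y-1)^(j/2) in T(H; x, y): the number of
-- A ⊆ E(H) whose term is (x-1)^(i/2) (y-1)^(j/2).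
tutteCoeff : Gehm → ℤ → ℤ → ℕ
tutteCoeff H i j =
  count (λ A → closed H A ∧ does (expX2 H A ℤ.≟ i) ∧ does (expY2 H A ℤ.≟ j))
        (allSubsets (Gehm.n H))

-- Complementation A ↦ E ∖ A maps the sets of hyperedges of ℍ* (which has the hyperedges of ℍ)
-- bijectively onto those of ℍ, and it exchanges the two exponents: with B = E ∖ A,
-- 2(ρ(ℍ*) − ρ(A)) = 2(d(B) − |B| − ρ(B)), and dually. Since 2ρ = v + d − e − f, the hyperedges and
-- d split additively between A and B (the vertices on A are closed under the matching b, so there
-- is an even number of them), and isolates enter v and f alike, this comes down to
--   v* + fᴬ + vᴮ = f* + vᴬ + fᴮ,
-- where v*, f* count the hypervertices (g–b cycles) and hyperfaces (r–g cycles) of ℍ*, vᴬ, fᴬ those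
-- of ℍ*|A and vᴮ, fᴮ those of ℍ|B, isolates aside. Deleting hyperedges only contracts chains of
-- g-edges, so a g–b cycle either meets A, where it survives as a hypervertex of ℍ*|A, or lies inside
-- B: v* = vᴬ + X; likewise f* = vᴮ + Y. Let m be r on A and b on B. The g–m cycles meeting A are the
-- hyperfaces of ℍ*|A, those meeting B the hyperfaces of ℍ|B, and those inside B (resp. A) are again
-- counted by X (resp. Y). Hence the number of g–m cycles is fᴬ + X = fᴮ + Y, which is the identity.

{-# OPTIONS --safe #-}
module Submission where

open import Defs
open import Data.Bool using (Bool; true; false; _∧_; _∨_; not; if_then_else_; T)
import Data.Bool as Bool
open import Data.Bool.ListAction using (all)
open import Data.Bool.Properties using (∧-comm; ∧-zeroʳ; not-involutive; T-≡; T-∧; T-∨)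
open import Data.Empty using (⊥-elim)
open import Data.Fin as Fin using (Fin; toℕ; _≟_)
import Data.Fin.Properties as Finₚ
open import Data.Integer using (ℤ)
import Data.Integer as ℤ
import Data.Integer.Properties as ZP
open import Data.Integer.Tactic.RingSolver using (solve-∀)
open import Data.List using (List; []; _∷_; _++_; allFin; tabulate; concatMap; length; map)
open import Data.List.Membership.Propositional using (_∈_)
open import Data.List.Membership.Propositional.Properties using (∈-allFin)
open import Data.List.Properties using (length-tabulate; map-++)
open import Data.List.Relation.Unary.All using (All; []; _∷_)
import Data.List.Relation.Unary.All.Properties as All
open import Data.List.Relation.Unary.All.Properties using (all⁺; all⁻)
open import Data.List.Relation.Unary.Any using (Any; here; there)
open import Data.List.Relation.Unary.Any.Properties using (any⁺; any⁻)
open import Data.Nat as ℕ using (ℕ; zero; suc; _+_; _∸_; _≤_; _<_; _≤ᵇ_; z≤n; s≤s; ⌊_/2⌋)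
open import Data.Nat.ListAction using (sum)
open import Data.Nat.ListAction.Properties using (sum-++)
import Data.Nat.Properties as ℕₚ
open import Data.Nat.Tactic.RingSolver renaming (solve-∀ to ℕ-solve-∀)
open import Data.Product using (∃; ∃-syntax; Σ-syntax; _×_; _,_; proj₁; proj₂)
open import Data.Sum using (_⊎_; inj₁; inj₂)
open import Data.Unit using (tt)
open import Function using (_∘_; id; Equivalence)
open import Level using (0ℓ)
open import Relation.Binary using (Rel; Symmetric; Transitive)
open import Relation.Binary.Construct.Closure.ReflexiveTransitive as Star using (Star; ε; _◅_; _◅◅_)
open import Relation.Binary.PropositionalEquality using (_≡_; _≢_; refl; sym; trans; cong; cong₂; subst; subst₂)
open import Relation.Binary.PropositionalEquality using (module ≡-Reasoning)
open import Relation.Nullary using (¬_; Dec; does; yes; no)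
open import Relation.Nullary.Decidable using (dec-true; T?)

private
  variable
    X : Set
    n : ℕ

T⇒≡true : ∀ {b} → T b → b ≡ true
T⇒≡true = Equivalence.to T-≡

¬T⇒≡false : ∀ {b} → ¬ T b → b ≡ false
¬T⇒≡false {false} _ = refl
¬T⇒≡false {true} ¬t = ⊥-elim (¬t tt)

≡true⇒T : ∀ {b} → b ≡ true → T b
≡true⇒T = Equivalence.from T-≡

≡false⇒¬T : ∀ {b} → b ≡ false → ¬ T b
≡false⇒¬T refl ()

T-∧⁺ : ∀ {a b} → T a → T b → T (a ∧ b)
T-∧⁺ ta tb = Equivalence.from T-∧ (ta , tb)

T-∧⁻ˡ : ∀ {a b} → T (a ∧ b) → T a
T-∧⁻ˡ {a} {b} = proj₁ ∘ Equivalence.to (T-∧ {a} {b})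

T-∧⁻ʳ : ∀ {a b} → T (a ∧ b) → T b
T-∧⁻ʳ {a} {b} = proj₂ ∘ Equivalence.to (T-∧ {a} {b})

T-not⁺ : ∀ {a} → ¬ T a → T (not a)
T-not⁺ {false} _ = tt
T-not⁺ {true} ¬ta = ¬ta tt

T-not⁻ : ∀ {a} → T (not a) → ¬ T a
T-not⁻ {false} _ ()

T-⇒⁺ : ∀ {a b} → (T a → T b) → T (not a ∨ b)
T-⇒⁺ {false} _ = tt
T-⇒⁺ {true} f = f tt

T-⇒⁻ : ∀ {a b} → T (not a ∨ b) → T a → T b
T-⇒⁻ {true} tb _ = tb

T-∨⁺ˡ : ∀ {a b} → T a → T (a ∨ b)
T-∨⁺ˡ ta = Equivalence.from T-∨ (inj₁ ta)

T-∨⁺ʳ : ∀ {a b} → T b → T (a ∨ b)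
T-∨⁺ʳ {a} tb = Equivalence.from (T-∨ {a}) (inj₂ tb)

T-∨⁻ : ∀ {a b} → T (a ∨ b) → T a ⊎ T b
T-∨⁻ {a} {b} = Equivalence.to (T-∨ {a} {b})

¬T-⇒ : ∀ {a b} → ¬ T (not a ∨ b) → T a × ¬ T b
¬T-⇒ {false} ¬t = ⊥-elim (¬t tt)
¬T-⇒ {true}  ¬t = tt , ¬t

T-injective : ∀ {a b} → (T a → T b) → (T b → T a) → a ≡ b
T-injective {false} {false} _ _ = refl
T-injective {false} {true} _ b⇒a = ⊥-elim (b⇒a tt)
T-injective {true} {false} a⇒b _ = ⊥-elim (a⇒b tt)
T-injective {true} {true} _ _ = refl

T-does⁺ : ∀ {P : Set} (P? : Dec P) → P → T (does P?)
T-does⁺ P? p = subst T (sym (dec-true P? p)) tt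

T-does⁻ : ∀ {P : Set} (P? : Dec P) → T (does P?) → P
T-does⁻ (yes p) _ = p

module _ {A B : X → Bool} (B≗¬A : ∀ x → B x ≡ not (A x)) where

  complement-sym : ∀ x → A x ≡ not (B x)
  complement-sym x = trans (sym (not-involutive (A x))) (cong not (sym (B≗¬A x)))

  complement⁺ : ∀ {x} → ¬ T (A x) → T (B x)
  complement⁺ {x} ¬ax = ≡true⇒T (trans (B≗¬A x) (cong not (¬T⇒≡false ¬ax)))

  complement⁻ : ∀ {x} → T (A x) → ¬ T (B x)
  complement⁻ {x} ax bx = T-not⁻ (subst T (B≗¬A x) bx) ax

  complement-invariant : ∀ {f : X → X} → (∀ x → A (f x) ≡ A x) → ∀ x → B (f x) ≡ B x
  complement-invariant {f} A-f x = trans (B≗¬A (f x)) (trans (cong not (A-f x)) (sym (B≗¬A x)))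

T-allFin⁺ : {p : Fin n → Bool} → (∀ i → T (p i)) → T (all p (allFin n))
T-allFin⁺ {p = p} h = all⁻ p (All.tabulate⁺ h)

T-allFin⁻ : {p : Fin n → Bool} → T (all p (allFin n)) → ∀ i → T (p i)
T-allFin⁻ {n} {p} t = All.tabulate⁻ (all⁺ p (allFin n) t)

module _ {p q : X → Bool} where

  count-cong : (∀ x → p x ≡ q x) → ∀ xs → count p xs ≡ count q xs
  count-cong p≗q [] = refl
  count-cong p≗q (x ∷ xs) rewrite p≗q x with q x
  ... | true  = cong suc (count-cong p≗q xs)
  ... | false = count-cong p≗q xs

  count-mono : (∀ x → T (p x) → T (q x)) → ∀ xs → count p xs ≤ count q xs
  count-mono p⇒q [] = z≤n
  count-mono p⇒q (x ∷ xs) with p x in px | q x in qx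
  ... | true  | true  = s≤s (count-mono p⇒q xs)
  ... | false | true  = ℕₚ.m≤n⇒m≤1+n (count-mono p⇒q xs)
  ... | false | false = count-mono p⇒q xs
  ... | true  | false = ⊥-elim (≡false⇒¬T qx (p⇒q x (≡true⇒T px)))

  count-mono-< : (∀ x → T (p x) → T (q x)) → ∀ {w xs} → w ∈ xs → ¬ T (p w) → T (q w) →
                 count p xs < count q xs
  count-mono-< p⇒q {w} {_ ∷ xs} (here refl) ¬pw qw with p w | q w
  ... | true  | _     = ⊥-elim (¬pw tt)
  ... | false | true  = s≤s (count-mono p⇒q xs)
  count-mono-< p⇒q {xs = x ∷ xs} (there w∈xs) ¬pw qw with p x in px | q x in qx
  ... | true  | true  = s≤s (count-mono-< p⇒q w∈xs ¬pw qw)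
  ... | false | true  = ℕₚ.m≤n⇒m≤1+n (count-mono-< p⇒q w∈xs ¬pw qw)
  ... | false | false = count-mono-< p⇒q w∈xs ¬pw qw
  ... | true  | false = ⊥-elim (≡false⇒¬T qx (p⇒q x (≡true⇒T px)))

count-split : (p q : X → Bool) → ∀ xs →
              count p xs ≡ count (λ x → p x ∧ q x) xs + count (λ x → p x ∧ not (q x)) xs
count-split p q [] = refl
count-split p q (x ∷ xs) with p x | q x
... | true  | true  = cong suc (count-split p q xs)
... | true  | false = trans (cong suc (count-split p q xs)) (sym (ℕₚ.+-suc _ _))
... | false | _     = count-split p q xs

count≤length : (p : X → Bool) → ∀ xs → count p xs ≤ length xs
count≤length p [] = z≤n
count≤length p (x ∷ xs) with p x
... | true  = s≤s (count≤length p xs)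
... | false = ℕₚ.m≤n⇒m≤1+n (count≤length p xs)

count-witness : (p : X → Bool) → ∀ xs {k} → count p xs ≡ suc k → ∃[ x ] T (p x)
count-witness p (x ∷ xs) eq with p x in px
... | true  = x , ≡true⇒T px
... | false = count-witness p xs eq

count-const-false : (xs : List X) → count (λ _ → false) xs ≡ 0
count-const-false [] = refl
count-const-false (x ∷ xs) = count-const-false xs

card : (Fin n → Bool) → ℕ
card {n} p = count p (allFin n)

card≤n : (p : Fin n → Bool) → card p ≤ n
card≤n {n} p = subst (card p ≤_) (length-tabulate id) (count≤length p (allFin n))

count-tabulate : (p : X → Bool) (f : Fin n → X) → count p (tabulate f) ≡ card (p ∘ f)
count-tabulate {n = zero} p f = refl
count-tabulate {n = suc n} p f with p (f Fin.zero)
... | true  = cong suc (trans (count-tabulate p (f ∘ Fin.suc)) (sym (count-tabulate (p ∘ f) Fin.suc)))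
... | false = trans (count-tabulate p (f ∘ Fin.suc)) (sym (count-tabulate (p ∘ f) Fin.suc))

card-singleton : (v : Fin n) → card (λ x → does (x ≟ v)) ≡ 1
card-singleton {suc n} Fin.zero =
  cong suc (trans (count-tabulate {n = n} (λ x → does (x ≟ Fin.zero)) Fin.suc) (count-const-false (allFin n)))
card-singleton {suc n} (Fin.suc v) =
  trans (count-tabulate {n = n} (λ x → does (x ≟ Fin.suc v)) Fin.suc) (card-singleton v)

remove : Fin n → (Fin n → Bool) → Fin n → Bool
remove v p x = p x ∧ not (does (x ≟ v))

remove⁺ : {p : Fin n → Bool} {v x : Fin n} → T (p x) → x ≢ v → T (remove v p x)
remove⁺ {v = v} {x} px x≢v = T-∧⁺ px (T-not⁺ λ t → x≢v (T-does⁻ (x ≟ v) t))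

remove⁻ : {p : Fin n → Bool} {v x : Fin n} → T (remove v p x) → T (p x) × x ≢ v
remove⁻ {p = p} {v} {x} t = T-∧⁻ˡ t , λ x≡v → T-not⁻ (T-∧⁻ʳ {p x} t) (T-does⁺ (x ≟ v) x≡v)

card-remove : (p : Fin n → Bool) {v : Fin n} → T (p v) → card p ≡ suc (card (remove v p))
card-remove {n} p {v} pv = begin
  card p                                               ≡⟨ count-split p (λ x → does (x ≟ v)) (allFin n) ⟩
  card (λ x → p x ∧ does (x ≟ v)) + card (remove v p)  ≡⟨ cong (_+ card (remove v p)) singleton ⟩
  suc (card (remove v p))                              ∎
  where
  open ≡-Reasoning
  on-v : ∀ x → (p x ∧ does (x ≟ v)) ≡ does (x ≟ v)
  on-v x with x ≟ v
  ... | yes refl = T-injective (λ _ → tt) (λ _ → T-∧⁺ pv tt)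
  ... | no _     = ∧-zeroʳ (p x)
  singleton : card (λ x → p x ∧ does (x ≟ v)) ≡ 1
  singleton = trans (count-cong on-v (allFin n)) (card-singleton v)

card-≤-injection : (p q : Fin n → Bool) (f : ∀ v → T (p v) → Fin n) →
                   (∀ v pv → T (q (f v pv))) →
                   (∀ v w pv pw → f v pv ≡ f w pw → v ≡ w) →
                   card p ≤ card q
card-≤-injection {n} p q f f-into f-inj = go (card p) p q refl f f-into f-inj
  where
  go : ∀ k (p q : Fin n → Bool) → card p ≡ k → (f : ∀ v → T (p v) → Fin n) →
       (∀ v pv → T (q (f v pv))) → (∀ v w pv pw → f v pv ≡ f w pw → v ≡ w) → card p ≤ card q
  go zero    p q #p≡0 f f-into f-inj = subst (_≤ card q) (sym #p≡0) z≤n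
  go (suc k) p q #p≡k f f-into f-inj with count-witness p (allFin n) #p≡k
  ... | v , pv = subst₂ _≤_ (sym (card-remove p pv)) (sym (card-remove q (f-into v pv)))
                   (s≤s (go k p′ q′ #p′≡k f′ f′-into f′-inj))
    where
    p′ q′ : Fin n → Bool
    p′ = remove v p
    q′ = remove (f v pv) q
    #p′≡k : card p′ ≡ k
    #p′≡k = ℕₚ.suc-injective (trans (sym (card-remove p pv)) #p≡k)
    f′ : ∀ x → T (p′ x) → Fin n
    f′ x p′x = f x (proj₁ (remove⁻ {p = p} p′x))
    f′-into : ∀ x p′x → T (q′ (f′ x p′x))
    f′-into x p′x = let px , x≢v = remove⁻ {p = p} p′x in
      remove⁺ {p = q} (f-into x px) (λ fx≡fv → x≢v (f-inj x v px pv fx≡fv))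
    f′-inj : ∀ x y p′x p′y → f′ x p′x ≡ f′ y p′y → x ≡ y
    f′-inj x y p′x p′y = f-inj x y (proj₁ (remove⁻ {p = p} p′x)) (proj₁ (remove⁻ {p = p} p′y))

module _ {_~_ : Rel (Fin n) 0ℓ} (~-sym : Symmetric _~_) (~-trans : Transitive _~_) where

  private
    injection : (P Q : Fin n → Bool) → (∀ v → T (P v) → ∃[ w ] T (Q w) × v ~ w) →
                (∀ v v′ → T (P v) → T (P v′) → v ~ v′ → v ≡ v′) → card P ≤ card Q
    injection P Q P→Q P-unique = card-≤-injection P Q (λ v pv → proj₁ (P→Q v pv))
      (λ v pv → proj₁ (proj₂ (P→Q v pv)))
      (λ v w pv pw fv≡fw → P-unique v w pv pw
         (~-trans (proj₂ (proj₂ (P→Q v pv)))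
           (subst (_~ w) (sym fv≡fw) (~-sym (proj₂ (proj₂ (P→Q w pw)))))))

  card-representatives : (P Q : Fin n → Bool) →
    (∀ v → T (P v) → ∃[ w ] T (Q w) × v ~ w) → (∀ w → T (Q w) → ∃[ v ] T (P v) × w ~ v) →
    (∀ v v′ → T (P v) → T (P v′) → v ~ v′ → v ≡ v′) → (∀ w w′ → T (Q w) → T (Q w′) → w ~ w′ → w ≡ w′) →
    card P ≡ card Q
  card-representatives P Q P→Q Q→P P-unique Q-unique =
    ℕₚ.≤-antisym (injection P Q P→Q P-unique) (injection Q P Q→P Q-unique)

¬all⇒∃¬ : (p : X → Bool) → ∀ xs → ¬ T (all p xs) → ∃[ x ] ¬ T (p x)
¬all⇒∃¬ p [] ¬all = ⊥-elim (¬all tt)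
¬all⇒∃¬ p (x ∷ xs) ¬all with p x in px
... | true  = ¬all⇒∃¬ p xs ¬all
... | false = x , ≡false⇒¬T px

least : (p : Fin n → Bool) → ∃ (T ∘ p) → Σ[ m ∈ Fin n ] T (p m) × (∀ x → T (p x) → m Fin.≤ x)
least {suc n} p (w , pw) with p Fin.zero in p0
... | true = Fin.zero , ≡true⇒T p0 , λ _ _ → z≤n
... | false with w
...   | Fin.zero   = ⊥-elim (≡false⇒¬T p0 pw)
...   | Fin.suc w′ with least (p ∘ Fin.suc) (w′ , pw)
...     | m , pm , m-least = Fin.suc m , pm , λ
          { Fin.zero px → ⊥-elim (≡false⇒¬T p0 px)
          ; (Fin.suc x) px → s≤s (m-least x px) }

-- Defs' isRep mask fs is isClassMin mask (connected fs), definitionally.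
isClassMin : (Fin n → Bool) → (Fin n → Fin n → Bool) → Fin n → Bool
isClassMin {n} mask c v = mask v ∧ all (λ w → not (mask w ∧ c v w) ∨ (toℕ v ≤ᵇ toℕ w)) (allFin n)

IsClassMin : (Fin n → Bool) → (Fin n → Fin n → Bool) → Fin n → Set
IsClassMin mask c v = T (mask v) × (∀ w → T (mask w) → T (c v w) → v Fin.≤ w)

isClassMin⁺ : ∀ mask (c : Fin n → Fin n → Bool) {v} → IsClassMin mask c v → T (isClassMin mask c v)
isClassMin⁺ mask c {v} (mv , v-min) = T-∧⁺ mv (T-allFin⁺ λ w →
  T-⇒⁺ λ t → ℕₚ.≤⇒≤ᵇ (v-min w (T-∧⁻ˡ t) (T-∧⁻ʳ {mask w} t)))

isClassMin⁻ : ∀ mask (c : Fin n → Fin n → Bool) {v} → T (isClassMin mask c v) → IsClassMin mask c v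
isClassMin⁻ mask c {v} t = T-∧⁻ˡ t , λ w mw cvw →
  ℕₚ.≤ᵇ⇒≤ (toℕ v) (toℕ w) (T-⇒⁻ (T-allFin⁻ (T-∧⁻ʳ {mask v} t) w) (T-∧⁺ mw cvw))

classMin-unique : ∀ {mask} {c : Fin n → Fin n → Bool} → (∀ {v w} → T (c v w) → T (c w v)) →
                  ∀ {v v′} → IsClassMin mask c v → IsClassMin mask c v′ → T (c v v′) → v ≡ v′
classMin-unique c-sym (mv , v-min) (mv′ , v′-min) cvv′ =
  Finₚ.≤-antisym (v-min _ mv′ cvv′) (v′-min _ mv (c-sym cvv′))

card-classMin-cong : ∀ mask {c c′ : Fin n → Fin n → Bool} →
                     (∀ v w → T (mask v) → T (mask w) → c v w ≡ c′ v w) →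
                     card (isClassMin mask c) ≡ card (isClassMin mask c′)
card-classMin-cong {n} mask {c} {c′} c≗c′ = count-cong pointwise (allFin n)
  where
  transport : ∀ {c c′ : Fin n → Fin n → Bool} → (∀ v w → T (mask v) → T (mask w) → c v w ≡ c′ v w) →
              ∀ v → T (isClassMin mask c v) → T (isClassMin mask c′ v)
  transport {c} {c′} c≗c′ v t = let mv , v-min = isClassMin⁻ mask c t in
    isClassMin⁺ mask c′ (mv , λ w mw c′vw → v-min w mw (subst T (sym (c≗c′ v w mv mw)) c′vw))
  pointwise : ∀ v → isClassMin mask c v ≡ isClassMin mask c′ v
  pointwise v = T-injective (transport c≗c′ v) (transport (λ v w mv mw → sym (c≗c′ v w mv mw)) v)

isClassMinWithin : (Fin n → Fin n → Bool) → (Fin n → Bool) → Fin n → Bool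
isClassMinWithin {n} c B v = isClassMin (λ _ → true) c v ∧ all (λ w → not (c v w) ∨ B w) (allFin n)

module _ {c : Fin n → Fin n → Bool}
         (c-refl : ∀ {v} → T (c v v))
         (c-sym : ∀ {v w} → T (c v w) → T (c w v))
         (c-trans : ∀ {u v w} → T (c u v) → T (c v w) → T (c u w)) where

  classes-split : ∀ {A B : Fin n → Bool} → (∀ x → B x ≡ not (A x)) →
                  card (isClassMin (λ _ → true) c) ≡ card (isClassMin A c) + card (isClassMinWithin c B)
  classes-split {A} {B} B≗¬A = begin
    card Min                            ≡⟨ count-split Min Within (allFin n) ⟩
    card MinWithin + card MinMeeting    ≡⟨ cong (card MinWithin +_) meeting≡ ⟩
    card MinWithin + card (MinOf A)     ≡⟨ ℕₚ.+-comm (card MinWithin) (card (MinOf A)) ⟩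
    card (MinOf A) + card MinWithin     ∎
    where
    open ≡-Reasoning
    MinOf : (Fin n → Bool) → Fin n → Bool
    MinOf A = isClassMin A c
    Min Within MinWithin MinMeeting : Fin n → Bool
    Min = MinOf (λ _ → true)
    Within v = all (λ w → not (c v w) ∨ B w) (allFin n)
    MinWithin = isClassMinWithin c B
    MinMeeting v = Min v ∧ not (Within v)

    meeting→min : ∀ v → T (MinMeeting v) → ∃[ m ] T (MinOf A m) × T (c v m)
    meeting→min v t with ¬all⇒∃¬ _ (allFin n) (T-not⁻ (T-∧⁻ʳ {Min v} t))
    ... | w , ¬[cvw⇒bw] with ¬T-⇒ ¬[cvw⇒bw]
    ...   | cvw , ¬bw with least (λ x → A x ∧ c v x) (w , T-∧⁺ (complement⁺ (complement-sym B≗¬A) ¬bw) cvw)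
    ...     | m , am∧cvm , m-least =
              m , isClassMin⁺ A c (am , λ x ax cmx → m-least x (T-∧⁺ ax (c-trans cvm cmx))) , cvm
      where
      am : T (A m)
      am = T-∧⁻ˡ am∧cvm
      cvm : T (c v m)
      cvm = T-∧⁻ʳ {A m} am∧cvm

    min→meeting : ∀ u → T (MinOf A u) → ∃[ m ] T (MinMeeting m) × T (c u m)
    min→meeting u t with least (c u) (u , c-refl)
    ... | m , cum , m-least = m , T-∧⁺ m-min (T-not⁺ m-not-within) , cum
      where
      m-min : T (Min m)
      m-min = isClassMin⁺ (λ _ → true) c (tt , λ x _ cmx → m-least x (c-trans cum cmx))
      m-not-within : ¬ T (Within m)
      m-not-within within = complement⁻ B≗¬A (proj₁ (isClassMin⁻ A c t)) (T-⇒⁻ (T-allFin⁻ within u) (c-sym cum))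

    meeting≡ : card MinMeeting ≡ card (MinOf A)
    meeting≡ = card-representatives {_~_ = λ v w → T (c v w)} c-sym c-trans MinMeeting (MinOf A)
      meeting→min min→meeting
      (λ v v′ t t′ → classMin-unique c-sym (isClassMin⁻ (λ _ → true) c (T-∧⁻ˡ t))
                                            (isClassMin⁻ (λ _ → true) c (T-∧⁻ˡ t′)))
      (λ w w′ t t′ → classMin-unique c-sym (isClassMin⁻ A c t) (isClassMin⁻ A c t′))

isClassMinWithin⁻ : ∀ (c : Fin n → Fin n → Bool) B {v} → T (isClassMinWithin c B v) →
                    IsClassMin (λ _ → true) c v × (∀ w → T (c v w) → T (B w))
isClassMinWithin⁻ c B t =
  isClassMin⁻ (λ _ → true) c (T-∧⁻ˡ t) , λ w → T-⇒⁻ (T-allFin⁻ (T-∧⁻ʳ {isClassMin (λ _ → true) c _} t) w)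

isClassMinWithin⁺ : ∀ (c : Fin n → Fin n → Bool) B {v} →
                    IsClassMin (λ _ → true) c v → (∀ w → T (c v w) → T (B w)) → T (isClassMinWithin c B v)
isClassMinWithin⁺ c B v-min within = T-∧⁺ (isClassMin⁺ (λ _ → true) c v-min) (T-allFin⁺ λ w → T-⇒⁺ (within w))

card-classMinWithin-cong : ∀ {c c′ : Fin n → Fin n → Bool} {B} →
  (∀ v → (∀ w → T (c v w) → T (B w)) → ∀ w → c v w ≡ c′ v w) →
  (∀ v → (∀ w → T (c′ v w) → T (B w)) → ∀ w → c′ v w ≡ c v w) →
  card (isClassMinWithin c B) ≡ card (isClassMinWithin c′ B)
card-classMinWithin-cong {n} {c} {c′} {B} agree agree′ =
  count-cong (λ v → T-injective (transport agree v) (transport agree′ v)) (allFin n)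
  where
  transport : ∀ {c c′ : Fin n → Fin n → Bool} → (∀ v → (∀ w → T (c v w) → T (B w)) → ∀ w → c v w ≡ c′ v w) →
              ∀ v → T (isClassMinWithin c B v) → T (isClassMinWithin c′ B v)
  transport {c} {c′} agree v t with isClassMinWithin⁻ c B t
  ... | (_ , v-min) , within = isClassMinWithin⁺ c′ B
          (tt , λ w _ c′vw → v-min w tt (subst T (sym (agree v within w)) c′vw))
          (λ w c′vw → within w (subst T (sym (agree v within w)) c′vw))

classMinWithin-closed : ∀ {c : Fin n → Fin n → Bool} {B} → (∀ {v} → T (c v v)) →
  (∀ {v w} → T (c v w) → B w ≡ B v) → ∀ v → isClassMinWithin c B v ≡ isClassMin B c v
classMinWithin-closed {c = c} {B} c-refl B-closed v = T-injective to from
  where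
  to : T (isClassMinWithin c B v) → T (isClassMin B c v)
  to t with isClassMinWithin⁻ c B t
  ... | (_ , v-min) , within = isClassMin⁺ B c (within v c-refl , λ w _ → v-min w tt)
  from : T (isClassMin B c v) → T (isClassMinWithin c B v)
  from t with isClassMin⁻ B c t
  ... | bv , v-min = isClassMinWithin⁺ c B (tt , λ w _ cvw → v-min w (B-in cvw) cvw) (λ _ → B-in)
    where
    B-in : ∀ {w} → T (c v w) → T (B w)
    B-in cvw = subst T (sym (B-closed cvw)) bv

Involution : (Fin n → Fin n) → Set
Involution f = ∀ x → f (f x) ≡ x

Step : List (Fin n → Fin n) → Rel (Fin n) 0ℓ
Step fs v w = Any (λ f → f v ≡ w) fs

Walk : List (Fin n → Fin n) → Rel (Fin n) 0ℓ
Walk fs = Star (Step fs)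

pattern first-colour  = here refl
pattern second-colour = there (here refl)

step-any : ∀ {fs} {P : Fin n → Set} {v u} → Step fs v u → P u → Any (λ f → P (f v)) fs
step-any (here refl) pu = here pu
step-any (there s)   pu = there (step-any s pu)

any-step : ∀ {fs} {P : Fin n → Set} {v} → Any (λ f → P (f v)) fs → ∃[ u ] Step fs v u × P u
any-step (here pfv) = _ , here refl , pfv
any-step {P = P} (there a) = let u , s , pu = any-step {P = P} a in u , there s , pu

step-sym : ∀ {fs : List (Fin n → Fin n)} → All Involution fs → ∀ {v w} → Step fs v w → Step fs w v
step-sym (f-invol ∷ _) {v} (here refl) = here (f-invol v)
step-sym (_ ∷ invols) (there s) = there (step-sym invols s)

step-swap : ∀ {f₁ f₂ : Fin n → Fin n} {v w} → Step (f₁ ∷ f₂ ∷ []) v w → Step (f₂ ∷ f₁ ∷ []) v w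
step-swap first-colour  = second-colour
step-swap second-colour = first-colour

module _ (fs : List (Fin n → Fin n)) where

  private
    R : ℕ → Fin n → Fin n → Bool
    R = reach fs

  reach-mono : ∀ k {v w} → T (R k v w) → T (R (suc k) v w)
  reach-mono k t = T-∨⁺ˡ t

  reach-mono-≤ : ∀ {k m} v w → k ≤ m → T (R k v w) → T (R m v w)
  reach-mono-≤ {m = zero}      v w z≤n   t = t
  reach-mono-≤ {k} {m = suc m} v w k≤1+m t with ℕₚ.m≤n⇒m<n∨m≡n k≤1+m
  ... | inj₁ k<1+m = reach-mono m (reach-mono-≤ v w (ℕₚ.≤-pred k<1+m) t)
  ... | inj₂ refl  = t

  reach-cons : ∀ k {v u} w → Step fs v u → T (R k u w) → T (R (suc k) v w)
  reach-cons k {v} w s t = T-∨⁺ʳ (any⁺ (λ f → R k (f v) w) (step-any {P = λ u → T (R k u w)} s t))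

  reach-uncons : ∀ k v w → T (R (suc k) v w) → T (R k v w) ⊎ ∃[ u ] Step fs v u × T (R k u w)
  reach-uncons k v w t with T-∨⁻ t
  ... | inj₁ t′ = inj₁ t′
  ... | inj₂ t′ = inj₂ (any-step {P = λ u → T (R k u w)} (any⁻ (λ f → R k (f v) w) fs t′))

  reach-snoc : ∀ k v {u w} → T (R k v u) → Step fs u w → T (R (suc k) v w)
  reach-snoc zero v {u} {w} t s with T-does⁻ (v ≟ u) t
  ... | refl = reach-cons 0 w s (T-does⁺ (w ≟ w) refl)
  reach-snoc (suc k) v {u} {w} t s with reach-uncons k v u t
  ... | inj₁ t′            = reach-mono (suc k) (reach-snoc k v t′ s)
  ... | inj₂ (v′ , s′ , t′) = reach-cons (suc k) w s′ (reach-snoc k v′ t′ s)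

  reach-unsnoc : ∀ k v w → T (R (suc k) v w) → T (R k v w) ⊎ ∃[ u ] T (R k v u) × Step fs u w
  reach-unsnoc zero v w t with reach-uncons 0 v w t
  ... | inj₁ t′ = inj₁ t′
  ... | inj₂ (u , s , t′) with T-does⁻ (u ≟ w) t′
  ...   | refl = inj₂ (v , T-does⁺ (v ≟ v) refl , s)
  reach-unsnoc (suc k) v w t with reach-uncons (suc k) v w t
  ... | inj₁ t′ with reach-unsnoc k v w t′
  ...   | inj₁ t″           = inj₁ (reach-mono k t″)
  ...   | inj₂ (u , t″ , s) = inj₂ (u , reach-mono k t″ , s)
  reach-unsnoc (suc k) v w t | inj₂ (v′ , s′ , t′) with reach-unsnoc k v′ w t′
  ...   | inj₁ t″           = inj₁ (reach-cons k w s′ t″)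
  ...   | inj₂ (u , t″ , s) = inj₂ (u , reach-cons k u s′ t″ , s)

  reach-sound : ∀ k {v w} → T (R k v w) → Walk fs v w
  reach-sound zero {v} {w} t with T-does⁻ (v ≟ w) t
  ... | refl = ε
  reach-sound (suc k) {v} {w} t with reach-uncons k v w t
  ... | inj₁ t′           = reach-sound k t′
  ... | inj₂ (u , s , t′) = s ◅ reach-sound k t′

  reach-complete : ∀ {v w} → Walk fs v w → ∃[ k ] T (R k v w)
  reach-complete {v} ε = 0 , T-does⁺ (v ≟ v) refl
  reach-complete {w = w} (s ◅ walk) = let k , t = reach-complete walk in suc k , reach-cons k w s t

  Stable : ℕ → Fin n → Set
  Stable k v = ∀ w → T (R (suc k) v w) → T (R k v w)

  stable-suc : ∀ {k v} → Stable k v → Stable (suc k) v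
  stable-suc {k} {v} stable w t with reach-unsnoc (suc k) v w t
  ... | inj₁ t′           = t′
  ... | inj₂ (u , t′ , s) = reach-snoc k v (stable u t′) s

  stable-+ : ∀ {k v} → Stable k v → ∀ m → Stable (m + k) v
  stable-+         stable zero    = stable
  stable-+ {k} {v} stable (suc m) = stable-suc {m + k} {v} (stable-+ stable m)

  stable-saturated : ∀ {k v} → Stable k v → ∀ m w → T (R (m + k) v w) → T (R k v w)
  stable-saturated         stable zero    w t = t
  stable-saturated {k} {v} stable (suc m) w t = stable-saturated stable m w (stable-+ {k} {v} stable m w t)

  -- The sets reach fs k v grow strictly with k until they stop changing, and they have at most n
  -- elements; so they are constant from k = n on.
  stable-or-grows : ∀ v k → (∃[ j ] j < k × Stable j v) ⊎ k < card (R k v)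
  stable-or-grows v zero = inj₂ (subst (_< card (R 0 v)) (count-const-false (allFin n))
    (count-mono-< (λ _ ()) (∈-allFin v) (λ ()) (T-does⁺ (v ≟ v) refl)))
  stable-or-grows v (suc k) with stable-or-grows v k
  ... | inj₁ (j , j<k , stable) = inj₁ (j , ℕₚ.m<n⇒m<1+n j<k , stable)
  ... | inj₂ k<#R with T? (all (λ w → not (R (suc k) v w) ∨ R k v w) (allFin n))
  ...   | yes all-in = inj₁ (k , ℕₚ.n<1+n k , λ w → T-⇒⁻ (T-allFin⁻ all-in w))
  ...   | no ¬all-in with ¬all⇒∃¬ _ (allFin n) ¬all-in
  ...     | w , w-new = let new , ¬old = ¬T-⇒ w-new in
            inj₂ (ℕₚ.≤-trans (s≤s k<#R) (count-mono-< (λ x → reach-mono k) (∈-allFin w) ¬old new))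

  reach-saturates : ∀ k v w → T (R k v w) → T (R n v w)
  reach-saturates k v w t with stable-or-grows v n
  ... | inj₁ (j , j<n , stable) = reach-mono-≤ v w (ℕₚ.<⇒≤ j<n)
          (stable-saturated stable k w (reach-mono-≤ v w (ℕₚ.m≤m+n k j) t))
  ... | inj₂ n<#R = ⊥-elim (ℕₚ.≤⇒≯ (card≤n (R n v)) n<#R)

  connected⁻ : ∀ {v w} → T (connected fs v w) → Walk fs v w
  connected⁻ = reach-sound n

  connected⁺ : ∀ {v w} → Walk fs v w → T (connected fs v w)
  connected⁺ {v} {w} walk = let k , t = reach-complete walk in reach-saturates k v w t

module _ {fs : List (Fin n → Fin n)} where

  connected-refl : ∀ {v} → T (connected fs v v)
  connected-refl = connected⁺ fs ε

  connected-sym : All Involution fs → ∀ {v w} → T (connected fs v w) → T (connected fs w v)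
  connected-sym invols t = connected⁺ fs (Star.reverse (step-sym invols) (connected⁻ fs t))

  connected-trans : ∀ {u v w} → T (connected fs u v) → T (connected fs v w) → T (connected fs u w)
  connected-trans t t′ = connected⁺ fs (connected⁻ fs t ◅◅ connected⁻ fs t′)

connected-swap : ∀ (f₁ f₂ : Fin n → Fin n) v w →
                 connected (f₁ ∷ f₂ ∷ []) v w ≡ connected (f₂ ∷ f₁ ∷ []) v w
connected-swap f₁ f₂ v w = T-injective (swap f₁ f₂) (swap f₂ f₁)
  where
  swap : ∀ f₁ f₂ → T (connected (f₁ ∷ f₂ ∷ []) v w) → T (connected (f₂ ∷ f₁ ∷ []) v w)
  swap f₁ f₂ = connected⁺ (f₂ ∷ f₁ ∷ []) ∘ Star.map step-swap ∘ connected⁻ (f₁ ∷ f₂ ∷ [])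

-- Leaving u ∈ S along g and then following φ, g, φ, g, … through
-- the vertices outside S until S is reached again is what exit computes (ψ is the colour the chain
-- actually uses; it agrees with φ outside S).
module Contraction
  {g φ ψ φ′ : Fin n → Fin n} {S : Fin n → Bool}
  (g-invol : Involution g) (φ-invol : Involution φ)
  (S-φ : ∀ x → S (φ x) ≡ S x)
  (ψ≗φ-outside : ∀ x → ¬ T (S x) → ψ x ≡ φ x)
  (φ′≗φ-inside : ∀ x → T (S x) → φ′ x ≡ φ x)
  (exit : ℕ → Fin n → Fin n)
  (exit-zero : ∀ u → exit 0 u ≡ u)
  (exit-suc : ∀ k u → exit (suc k) u ≡ (if S u then u else exit k (g (ψ u))))
  where

  gS : Fin n → Fin n
  gS u = exit n (g u)

  σ : Fin n → Fin n
  σ u = g (φ u)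

  σ^ : ℕ → Fin n → Fin n
  σ^ zero    u = u
  σ^ (suc i) u = σ (σ^ i u)

  σ^-suc : ∀ i u → σ^ (suc i) u ≡ σ^ i (σ u)
  σ^-suc zero    u = refl
  σ^-suc (suc i) u = cong σ (σ^-suc i u)

  σ-retract : ∀ x → φ (g (σ x)) ≡ x
  σ-retract x = trans (cong φ (g-invol (φ x))) (φ-invol x)

  σ-injective : ∀ {x y} → σ x ≡ σ y → x ≡ y
  σ-injective {x} {y} eq = trans (sym (σ-retract x)) (trans (cong (φ ∘ g) eq) (σ-retract y))

  σ^-cancel : ∀ i d x → σ^ i x ≡ σ^ (i + d) x → x ≡ σ^ d x
  σ^-cancel zero    d x eq = eq
  σ^-cancel (suc i) d x eq = σ^-cancel i d x (σ-injective eq)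

  φ-preserves-S : ∀ {x} → T (S x) → T (S (φ x))
  φ-preserves-S {x} sx = subst T (sym (S-φ x)) sx

  exit-stop : ∀ k {u} → T (S u) → exit (suc k) u ≡ u
  exit-stop k {u} su = trans (exit-suc k u) (cong (λ s → if s then u else _) (T⇒≡true su))

  exit-step : ∀ k {u} → ¬ T (S u) → exit (suc k) u ≡ exit k (σ u)
  exit-step k {u} ¬su = trans (exit-suc k u) (trans
    (cong (λ s → if s then u else exit k (g (ψ u))) (¬T⇒≡false ¬su))
    (cong (exit k ∘ g) (ψ≗φ-outside u ¬su)))

  -- σ is a permutation, so the orbit of g a comes back to σ⁻¹ (g a) = φ a ∈ S.
  chain-returns : ∀ {a} → T (S a) → ∃[ d ] d < n × T (S (σ^ d (g a)))
  chain-returns {a} sa with Finₚ.pigeonhole (ℕₚ.n<1+n n) (λ i → σ^ (toℕ i) (g a))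
  ... | i , j , i<j , eq = d , d<n , subst (T ∘ S) (sym σ^d≡φa) (φ-preserves-S sa)
    where
    d : ℕ
    d = toℕ j ∸ suc (toℕ i)
    i+1+d≡j : toℕ i + suc d ≡ toℕ j
    i+1+d≡j = trans (ℕₚ.+-suc (toℕ i) d) (ℕₚ.m+[n∸m]≡n i<j)
    loop : g a ≡ σ (σ^ d (g a))
    loop = σ^-cancel (toℕ i) (suc d) (g a) (trans eq (cong (λ k → σ^ k (g a)) (sym i+1+d≡j)))
    σ^d≡φa : σ^ d (g a) ≡ φ a
    σ^d≡φa = trans (sym (σ-retract (σ^ d (g a)))) (trans (cong (φ ∘ g) (sym loop)) (cong φ (g-invol a)))
    d<n : d < n
    d<n = ℕₚ.≤-trans (ℕₚ.≤-trans (ℕₚ.m≤n+m (suc d) (toℕ i)) (ℕₚ.≤-reflexive i+1+d≡j)) (ℕₚ.≤-pred (Finₚ.toℕ<n j))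

  FirstReturn : Fin n → ℕ → Set
  FirstReturn a i = i < n × T (S (σ^ i (g a))) × (∀ j → j < i → ¬ T (S (σ^ j (g a))))

  first-return : ∀ {a} → T (S a) → ∃[ i ] FirstReturn a i
  first-return {a} sa with chain-returns sa
  ... | d , d<n , sd
    with least (λ k → S (σ^ (toℕ k) (g a)))
               (Fin.fromℕ< d<n , subst (λ k → T (S (σ^ k (g a)))) (sym (Finₚ.toℕ-fromℕ< d<n)) sd)
  ...   | m , sm , m-least = toℕ m , Finₚ.toℕ<n m , sm , before
    where
    before : ∀ j → j < toℕ m → ¬ T (S (σ^ j (g a)))
    before j j<m sj = ℕₚ.<⇒≱ j<m (subst (toℕ m ≤_) (Finₚ.toℕ-fromℕ< j<n)
      (m-least (Fin.fromℕ< j<n) (subst (λ k → T (S (σ^ k (g a)))) (sym (Finₚ.toℕ-fromℕ< j<n)) sj)))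
      where
      j<n : j < n
      j<n = ℕₚ.<-trans j<m (Finₚ.toℕ<n m)

  exit-at : ∀ i k x → (∀ j → j < i → ¬ T (S (σ^ j x))) → T (S (σ^ i x)) → i ≤ k → exit k x ≡ σ^ i x
  exit-at zero    zero    x _       sx _   = exit-zero x
  exit-at zero    (suc k) x _       sx _   = exit-stop k sx
  exit-at (suc i) (suc k) x outside si (s≤s i≤k) = begin
    exit (suc k) x  ≡⟨ exit-step k (outside 0 (s≤s z≤n)) ⟩
    exit k (σ x)    ≡⟨ exit-at i k (σ x) outside′ (subst (T ∘ S) (σ^-suc i x) si) i≤k ⟩
    σ^ i (σ x)      ≡⟨ σ^-suc i x ⟨
    σ^ (suc i) x    ∎
    where
    open ≡-Reasoning
    outside′ : ∀ j → j < i → ¬ T (S (σ^ j (σ x)))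
    outside′ j j<i = subst (¬_ ∘ T ∘ S) (σ^-suc j x) (outside (suc j) (s≤s j<i))

  gS-first-return : ∀ {a i} → FirstReturn a i → gS a ≡ σ^ i (g a)
  gS-first-return {a} {i} (i<n , si , before) = exit-at i n (g a) before si (ℕₚ.<⇒≤ i<n)

  gS-inside : ∀ {a} → T (S a) → T (S (gS a))
  gS-inside sa = let i , ret = first-return sa in
    subst (T ∘ S) (sym (gS-first-return ret)) (proj₁ (proj₂ ret))

  private
    Walk-full Walk-contracted : Fin n → Fin n → Set
    Walk-full       = Walk (g ∷ φ ∷ [])
    Walk-contracted = Walk (gS ∷ φ′ ∷ [])

  exit-walk : ∀ k x → Walk-full x (exit k x)
  exit-walk zero    x = subst (Walk-full x) (sym (exit-zero x)) ε
  exit-walk (suc k) x with T? (S x)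
  ... | yes sx = subst (Walk-full x) (sym (exit-stop k sx)) ε
  ... | no ¬sx = subst (Walk-full x) (sym (exit-step k ¬sx)) (second-colour ◅ first-colour ◅ exit-walk k (σ x))

  forward : ∀ {v w} → T (S v) → Walk-contracted v w → Walk-full v w
  forward sv ε = ε
  forward {v} sv (first-colour ◅ walk) = first-colour ◅ exit-walk n (g v) ◅◅ forward (gS-inside sv) walk
  forward {v} {w} sv (second-colour ◅ walk) =
    second-colour ◅ subst (λ u → Walk-full u w) (φ′≗φ-inside v sv) (forward sφ′v walk)
    where
    sφ′v : T (S (φ′ v))
    sφ′v = subst (T ∘ S) (sym (φ′≗φ-inside v sv)) (φ-preserves-S sv)

  -- The invariant of backward: every vertex outside S met by a walk from v ∈ S lies on the chain
  -- leaving some a ∈ S that the contracted structure reaches from v.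
  OnChain : Fin n → Fin n → Set
  OnChain a u = Σ[ i ∈ ℕ ] (∀ j → j ≤ i → ¬ T (S (σ^ j (g a)))) × (u ≡ σ^ i (g a) ⊎ u ≡ φ (σ^ i (g a)))

  Reached : Fin n → Fin n → Set
  Reached v u = (T (S u) × Walk-contracted v u) ⊎ (Σ[ a ∈ Fin n ] T (S a) × Walk-contracted v a × OnChain a u)

  on-chain-outside : ∀ {a u} → OnChain a u → ¬ T (S u)
  on-chain-outside (i , outside , inj₁ refl) = outside i ℕₚ.≤-refl
  on-chain-outside (i , outside , inj₂ refl) = outside i ℕₚ.≤-refl ∘ subst T (S-φ _)

  reached-φ : ∀ {v u} → Reached v u → Reached v (φ u)
  reached-φ {v} {u} (inj₁ (su , walk)) =
    inj₁ (φ-preserves-S su , subst (Walk-contracted v) (φ′≗φ-inside u su) (walk ◅◅ second-colour ◅ ε))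
  reached-φ (inj₂ (a , sa , walk , i , outside , inj₁ refl)) = inj₂ (a , sa , walk , i , outside , inj₂ refl)
  reached-φ (inj₂ (a , sa , walk , i , outside , inj₂ refl)) =
    inj₂ (a , sa , walk , i , outside , inj₁ (φ-invol _))

  reached-g : ∀ {v u} → Reached v u → Reached v (g u)
  reached-g {v} {u} (inj₁ (su , walk)) with T? (S (g u))
  ... | yes sgu =
    inj₁ (sgu , subst (Walk-contracted v) (exit-at 0 n (g u) (λ _ ()) sgu z≤n) (walk ◅◅ first-colour ◅ ε))
  ... | no ¬sgu = inj₂ (u , su , walk , 0 , (λ { zero z≤n → ¬sgu }) , inj₁ refl)
  reached-g {v} (inj₂ (a , sa , walk , zero , outside , inj₁ refl)) =
    inj₁ (subst (T ∘ S) (sym (g-invol a)) sa , subst (Walk-contracted v) (sym (g-invol a)) walk)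
  reached-g (inj₂ (a , sa , walk , suc i , outside , inj₁ refl)) =
    inj₂ (a , sa , walk , i , (λ j j≤i → outside j (ℕₚ.m≤n⇒m≤1+n j≤i)) , inj₂ (g-invol _))
  reached-g {v} (inj₂ (a , sa , walk , i , outside , inj₂ refl)) with T? (S (σ^ (suc i) (g a)))
  ... | yes s = inj₁ (s , subst (Walk-contracted v) gSa≡ (walk ◅◅ first-colour ◅ ε))
    where
    i<n : suc i ≤ n
    i<n with first-return sa
    ... | i₀ , i₀<n , si₀ , _ with i₀ ℕ.≤? i
    ...   | yes i₀≤i = ⊥-elim (outside i₀ i₀≤i si₀)
    ...   | no  i₀≰i = ℕₚ.≤-trans (ℕₚ.≰⇒> i₀≰i) (ℕₚ.<⇒≤ i₀<n)
    gSa≡ : gS a ≡ σ^ (suc i) (g a)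
    gSa≡ = exit-at (suc i) n (g a) (λ j j<1+i → outside j (ℕₚ.≤-pred j<1+i)) s i<n
  ... | no ¬s = inj₂ (a , sa , walk , suc i , outside′ , inj₁ refl)
    where
    outside′ : ∀ j → j ≤ suc i → ¬ T (S (σ^ j (g a)))
    outside′ j j≤1+i with ℕₚ.m≤n⇒m<n∨m≡n j≤1+i
    ... | inj₁ j<1+i = outside j (ℕₚ.≤-pred j<1+i)
    ... | inj₂ refl  = ¬s

  reached-walk : ∀ {v u w} → Reached v u → Walk-full u w → Reached v w
  reached-walk r ε                       = r
  reached-walk r (first-colour  ◅ walk) = reached-walk (reached-g r) walk
  reached-walk r (second-colour ◅ walk) = reached-walk (reached-φ r) walk

  backward : ∀ {v w} → T (S v) → T (S w) → Walk-full v w → Walk-contracted v w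
  backward sv sw walk with reached-walk (inj₁ (sv , ε)) walk
  ... | inj₁ (_ , walk′)            = walk′
  ... | inj₂ (_ , _ , _ , on-chain) = ⊥-elim (on-chain-outside on-chain sw)

  contraction : ∀ {v w} → T (S v) → T (S w) → connected (gS ∷ φ′ ∷ []) v w ≡ connected (g ∷ φ ∷ []) v w
  contraction sv sw = T-injective
    (connected⁺ (g ∷ φ ∷ []) ∘ forward sv ∘ connected⁻ (gS ∷ φ′ ∷ []))
    (connected⁺ (gS ∷ φ′ ∷ []) ∘ backward sv sw ∘ connected⁻ (g ∷ φ ∷ []))

module _ {f₁ f₂ f₂′ : Fin n → Fin n} {B : Fin n → Bool} (f₂≗f₂′ : ∀ x → T (B x) → f₂ x ≡ f₂′ x) where

  private
    step-agree : ∀ {f₂ f₂′ : Fin n → Fin n} → (∀ x → T (B x) → f₂ x ≡ f₂′ x) →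
                 ∀ {u w} → T (B u) → Step (f₁ ∷ f₂ ∷ []) u w → Step (f₁ ∷ f₂′ ∷ []) u w
    step-agree _ _ first-colour = first-colour
    step-agree agree {u} bu second-colour = subst (Step _ u) (sym (agree u bu)) second-colour

  class-within-agree : ∀ {v} → (∀ w → T (connected (f₁ ∷ f₂ ∷ []) v w) → T (B w)) →
                       ∀ w → connected (f₁ ∷ f₂ ∷ []) v w ≡ connected (f₁ ∷ f₂′ ∷ []) v w
  class-within-agree {v} within w = T-injective
    (connected⁺ (f₁ ∷ f₂′ ∷ []) ∘ to ε ∘ connected⁻ (f₁ ∷ f₂ ∷ []))
    (connected⁺ (f₁ ∷ f₂ ∷ []) ∘ from ε ∘ connected⁻ (f₁ ∷ f₂′ ∷ []))
    where
    in-B : ∀ {u} → Walk (f₁ ∷ f₂ ∷ []) v u → T (B u)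
    in-B walk = within _ (connected⁺ (f₁ ∷ f₂ ∷ []) walk)
    to : ∀ {u w} → Walk (f₁ ∷ f₂ ∷ []) v u → Walk (f₁ ∷ f₂ ∷ []) u w → Walk (f₁ ∷ f₂′ ∷ []) u w
    to prefix ε = ε
    to prefix (s ◅ walk) = step-agree f₂≗f₂′ (in-B prefix) s ◅ to (prefix ◅◅ s ◅ ε) walk
    from : ∀ {u w} → Walk (f₁ ∷ f₂ ∷ []) v u → Walk (f₁ ∷ f₂′ ∷ []) u w → Walk (f₁ ∷ f₂ ∷ []) v w
    from prefix ε = prefix
    from prefix (s ◅ walk) = from (prefix ◅◅ step-agree (λ x bx → sym (f₂≗f₂′ x bx)) (in-B prefix) s ◅ ε) walk

card-classMinWithin-agree : ∀ {f₁ f₂ f₂′ : Fin n → Fin n} {B} → (∀ x → T (B x) → f₂ x ≡ f₂′ x) →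
  card (isClassMinWithin (connected (f₁ ∷ f₂ ∷ [])) B) ≡ card (isClassMinWithin (connected (f₁ ∷ f₂′ ∷ [])) B)
card-classMinWithin-agree f₂≗f₂′ = card-classMinWithin-cong
  (λ v → class-within-agree f₂≗f₂′)
  (λ v → class-within-agree (λ x bx → sym (f₂≗f₂′ x bx)))

step-preserves : ∀ {fs : List (Fin n → Fin n)} {B : Fin n → Bool} → All (λ f → ∀ x → B (f x) ≡ B x) fs →
                 ∀ {v w} → Step fs v w → B w ≡ B v
step-preserves (f-closed ∷ _) {v} (here refl) = f-closed v
step-preserves (_ ∷ closed)       (there s)   = step-preserves closed s

walk-preserves : ∀ {fs : List (Fin n → Fin n)} {B : Fin n → Bool} → All (λ f → ∀ x → B (f x) ≡ B x) fs →
                 ∀ {v w} → Walk fs v w → B w ≡ B v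
walk-preserves closed ε          = refl
walk-preserves closed (s ◅ walk) = trans (walk-preserves closed walk) (step-preserves closed s)

classes-split-bicoloured : ∀ {f₁ f₂ : Fin n → Fin n} → Involution f₁ → Involution f₂ →
  ∀ {A B} → (∀ x → B x ≡ not (A x)) →
  classes (λ _ → true) (f₁ ∷ f₂ ∷ [])
  ≡ classes A (f₁ ∷ f₂ ∷ []) + card (isClassMinWithin (connected (f₁ ∷ f₂ ∷ [])) B)
classes-split-bicoloured {f₁ = f₁} {f₂} f₁-invol f₂-invol = classes-split
  (connected-refl {fs = f₁ ∷ f₂ ∷ []}) (connected-sym (f₁-invol ∷ f₂-invol ∷ [])) (connected-trans {fs = f₁ ∷ f₂ ∷ []})

card-classMinWithin-closed : ∀ {fs : List (Fin n → Fin n)} {B : Fin n → Bool} →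
  All (λ f → ∀ x → B (f x) ≡ B x) fs →
  card (isClassMinWithin (connected fs) B) ≡ card (isClassMin B (connected fs))
card-classMinWithin-closed {n} {fs} closed = count-cong
  (classMinWithin-closed (connected-refl {fs = fs}) (walk-preserves closed ∘ connected⁻ fs)) (allFin n)

-- A set closed under a fixed-point-free involution f is halved by comparing x with f x.
card-even-involution : (f : Fin n → Fin n) → Involution f → (∀ x → f x ≢ x) →
                         (A : Fin n → Bool) → (∀ x → A (f x) ≡ A x) →
                         ∃[ m ] card A ≡ m + m
card-even-involution {n} f f-invol f-fpf A A-closed =
  card below , trans (count-split A lt (allFin n)) (cong (card below +_) (sym below≡above))
  where
  lt below above : Fin n → Bool
  lt x    = does (x Fin.<? f x)
  below x = A x ∧ lt x
  above x = A x ∧ not (lt x)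

  A-f : ∀ {x} → T (A x) → T (A (f x))
  A-f {x} ax = subst T (sym (A-closed x)) ax

  below→above : ∀ x → T (below x) → T (above (f x))
  below→above x t = T-∧⁺ (A-f (T-∧⁻ˡ t)) (T-not⁺ λ fx<x →
    ℕₚ.<-asym (T-does⁻ (x Fin.<? f x) (T-∧⁻ʳ {A x} t))
              (subst (f x Fin.<_) (f-invol x) (T-does⁻ (f x Fin.<? f (f x)) fx<x)))

  above→below : ∀ x → T (above x) → T (below (f x))
  above→below x t =
    T-∧⁺ (A-f (T-∧⁻ˡ t)) (T-does⁺ (f x Fin.<? f (f x)) (subst (f x Fin.<_) (sym (f-invol x)) fx<x))
    where
    fx<x : f x Fin.< x
    fx<x = Finₚ.≤∧≢⇒< (ℕₚ.≮⇒≥ (T-not⁻ (T-∧⁻ʳ {A x} t) ∘ T-does⁺ (x Fin.<? f x))) (f-fpf x)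

  f-injective : ∀ x y → f x ≡ f y → x ≡ y
  f-injective x y fx≡fy = trans (sym (f-invol x)) (trans (cong f fx≡fy) (f-invol y))

  below≡above : card below ≡ card above
  below≡above = ℕₚ.≤-antisym
    (card-≤-injection below above (λ x _ → f x) below→above (λ x y _ _ → f-injective x y))
    (card-≤-injection above below (λ x _ → f x) above→below (λ x y _ _ → f-injective x y))

⌊m+m+n/2⌋ : ∀ m n → ⌊ (m + m) + n /2⌋ ≡ m + ⌊ n /2⌋
⌊m+m+n/2⌋ zero    n = refl
⌊m+m+n/2⌋ (suc m) n rewrite ℕₚ.+-suc m m = cong suc (⌊m+m+n/2⌋ m n)

⌊n/2⌋-split : (f : Fin n → Fin n) → Involution f → (∀ x → f x ≢ x) →
              {A B : Fin n → Bool} → (∀ x → A (f x) ≡ A x) → (∀ x → B x ≡ not (A x)) →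
              ⌊ count (λ _ → true) (allFin n) /2⌋ ≡ ⌊ card A /2⌋ + ⌊ card B /2⌋
⌊n/2⌋-split {n} f f-invol f-fpf {A} {B} A-closed B≗¬A with card-even-involution f f-invol f-fpf A A-closed
... | m , #A≡m+m = begin
  ⌊ count (λ _ → true) (allFin n) /2⌋  ≡⟨ cong ⌊_/2⌋ (count-split (λ _ → true) A (allFin n)) ⟩
  ⌊ card A + card (not ∘ A) /2⌋        ≡⟨ cong₂ (λ a b → ⌊ a + b /2⌋) #A≡m+m (sym (count-cong B≗¬A (allFin n))) ⟩
  ⌊ (m + m) + card B /2⌋               ≡⟨ ⌊m+m+n/2⌋ m (card B) ⟩
  m + ⌊ card B /2⌋                     ≡⟨ cong (_+ ⌊ card B /2⌋) (ℕₚ.n≡⌊n+n/2⌋ m) ⟩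
  ⌊ m + m /2⌋ + ⌊ card B /2⌋           ≡⟨ cong (λ a → ⌊ a /2⌋ + ⌊ card B /2⌋) #A≡m+m ⟨
  ⌊ card A /2⌋ + ⌊ card B /2⌋          ∎
  where open ≡-Reasoning

sum-map-concatMap : ∀ {Y : Set} (f : Y → ℕ) (F : X → List Y) xs →
                    sum (map f (concatMap F xs)) ≡ sum (map (λ x → sum (map f (F x))) xs)
sum-map-concatMap f F []       = refl
sum-map-concatMap f F (x ∷ xs) = begin
  sum (map f (F x ++ concatMap F xs))               ≡⟨ cong sum (map-++ f (F x) (concatMap F xs)) ⟩
  sum (map f (F x) ++ map f (concatMap F xs))       ≡⟨ sum-++ (map f (F x)) (map f (concatMap F xs)) ⟩
  sum (map f (F x)) + sum (map f (concatMap F xs))  ≡⟨ cong (sum (map f (F x)) +_) (sum-map-concatMap f F xs) ⟩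
  sum (map f (F x)) + sum (map (λ x → sum (map f (F x))) xs) ∎
  where open ≡-Reasoning

sum-allSubsets-complement : ∀ n (f g : (Fin n → Bool) → ℕ) →
  (∀ A B → (∀ x → B x ≡ not (A x)) → f A ≡ g B) →
  sum (map f (allSubsets n)) ≡ sum (map g (allSubsets n))
sum-allSubsets-complement zero    f g f≡g = cong (_+ 0) (f≡g _ _ λ ())
sum-allSubsets-complement (suc n) f g f≡g =
  trans (sum-map-concatMap f _ (allSubsets n))
    (trans (sum-allSubsets-complement n _ _ λ A B B≗¬A → swap
              (f≡g _ _ λ { Fin.zero → refl ; (Fin.suc i) → B≗¬A i })
              (f≡g _ _ λ { Fin.zero → refl ; (Fin.suc i) → B≗¬A i }))
           (sym (sum-map-concatMap g _ (allSubsets n))))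
  where
  -- the extension of A by 0 ↦ false is complementary to that of B by 0 ↦ true, and vice versa
  swap : ∀ {a b c d} → a ≡ d → b ≡ c → a + (b + 0) ≡ c + (d + 0)
  swap {a} {b} refl refl = trans (cong (a +_) (ℕₚ.+-identityʳ b))
    (trans (ℕₚ.+-comm a b) (cong (b +_) (sym (ℕₚ.+-identityʳ a))))

count-as-sum : (p : X → Bool) → ∀ xs → count p xs ≡ sum (map (λ x → count p (x ∷ [])) xs)
count-as-sum p []       = refl
count-as-sum p (x ∷ xs) with p x
... | true  = cong suc (count-as-sum p xs)
... | false = count-as-sum p xs

count-allSubsets-complement : ∀ n (p q : (Fin n → Bool) → Bool) →
  (∀ A B → (∀ x → B x ≡ not (A x)) → p A ≡ q B) →
  count p (allSubsets n) ≡ count q (allSubsets n)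
count-allSubsets-complement n p q p≡q = begin
  count p (allSubsets n)
    ≡⟨ count-as-sum p (allSubsets n) ⟩
  sum (map (λ A → count p (A ∷ [])) (allSubsets n))
    ≡⟨ sum-allSubsets-complement n _ _ (λ A B B≗¬A → cong (λ b → if b then 1 else 0) (p≡q A B B≗¬A)) ⟩
  sum (map (λ B → count q (B ∷ [])) (allSubsets n))
    ≡⟨ count-as-sum q (allSubsets n) ⟨
  count q (allSubsets n)
    ∎
  where open ≡-Reasoning

twiceρ : ℤ → ℤ → ℤ → ℤ → ℤ
twiceρ v d e f = (v ℤ.+ d) ℤ.- (e ℤ.+ f)

module _ where
  -- scoped, since +_ would make the sections (m +_) of ℕ's addition ambiguous
  open import Data.Integer using (+_)

  twoρQ≡twiceρ : (P : PreGehm n) → let open Quantities P in twoρQ ≡ twiceρ (+ vQ) (+ dQ) (+ eQ) (+ fQ)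
  twoρQ≡twiceρ P rewrite ZP.pos-* 2 (Quantities.vQ P) | ZP.pos-* 2 (Quantities.kQ P) =
    k-cancels (+ vQ) (+ kQ) (+ eQ) (+ dQ) (+ fQ)
    where
    open Quantities P
    k-cancels : ∀ v k e d f → ((+ 2) ℤ.* v ℤ.- (+ 2) ℤ.* k) ℤ.+ (((((+ 2) ℤ.* k ℤ.- v) ℤ.- e) ℤ.+ d) ℤ.- f)
                              ≡ (v ℤ.+ d) ℤ.- (e ℤ.+ f)
    k-cancels = solve-∀

  -- The summands + 0 are those of eQ in Defs, so that instances check definitionally.
  exponent-identity : ∀ v* f* e* vᴬ fᴬ eᴬ vᴮ fᴮ eᴮ d dᴬ dᴮ i iᴬ iᴮ →
    e* ≡ eᴬ ℤ.+ eᴮ → d ≡ dᴬ ℤ.+ dᴮ → v* ℤ.+ fᴬ ℤ.+ vᴮ ≡ f* ℤ.+ vᴬ ℤ.+ fᴮ →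
    twiceρ (v* ℤ.+ i) d (e* ℤ.+ + 0) (f* ℤ.+ i) ℤ.- twiceρ (vᴬ ℤ.+ iᴬ) dᴬ (eᴬ ℤ.+ + 0) (fᴬ ℤ.+ iᴬ)
    ≡ + 2 ℤ.* dᴮ ℤ.- + 2 ℤ.* eᴮ ℤ.- twiceρ (vᴮ ℤ.+ iᴮ) dᴮ (eᴮ ℤ.+ + 0) (fᴮ ℤ.+ iᴮ)
  exponent-identity v* f* e* vᴬ fᴬ eᴬ vᴮ fᴮ eᴮ d dᴬ dᴮ i iᴬ iᴮ refl refl balance = begin
    twiceρ (v* ℤ.+ i) (dᴬ ℤ.+ dᴮ) ((eᴬ ℤ.+ eᴮ) ℤ.+ + 0) (f* ℤ.+ i)
      ℤ.- twiceρ (vᴬ ℤ.+ iᴬ) dᴬ (eᴬ ℤ.+ + 0) (fᴬ ℤ.+ iᴬ)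
      ≡⟨ rearrange v* f* vᴬ fᴬ eᴬ vᴮ fᴮ eᴮ dᴬ dᴮ i iᴬ iᴮ ⟩
    rhs ℤ.+ ((v* ℤ.+ fᴬ ℤ.+ vᴮ) ℤ.- (f* ℤ.+ vᴬ ℤ.+ fᴮ))
      ≡⟨ cong (λ z → rhs ℤ.+ (z ℤ.- (f* ℤ.+ vᴬ ℤ.+ fᴮ))) balance ⟩
    rhs ℤ.+ ((f* ℤ.+ vᴬ ℤ.+ fᴮ) ℤ.- (f* ℤ.+ vᴬ ℤ.+ fᴮ))
      ≡⟨ trans (cong (λ z → rhs ℤ.+ z) (ZP.+-inverseʳ (f* ℤ.+ vᴬ ℤ.+ fᴮ))) (ZP.+-identityʳ rhs) ⟩
    rhs ∎
    where
    open ≡-Reasoning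
    rhs : ℤ
    rhs = + 2 ℤ.* dᴮ ℤ.- + 2 ℤ.* eᴮ ℤ.- twiceρ (vᴮ ℤ.+ iᴮ) dᴮ (eᴮ ℤ.+ + 0) (fᴮ ℤ.+ iᴮ)
    rearrange : ∀ v* f* vᴬ fᴬ eᴬ vᴮ fᴮ eᴮ dᴬ dᴮ i iᴬ iᴮ →
      (((v* ℤ.+ i) ℤ.+ (dᴬ ℤ.+ dᴮ)) ℤ.- (((eᴬ ℤ.+ eᴮ) ℤ.+ + 0) ℤ.+ (f* ℤ.+ i)))
        ℤ.- (((vᴬ ℤ.+ iᴬ) ℤ.+ dᴬ) ℤ.- ((eᴬ ℤ.+ + 0) ℤ.+ (fᴬ ℤ.+ iᴬ)))
      ≡ (+ 2 ℤ.* dᴮ ℤ.- + 2 ℤ.* eᴮ ℤ.- (((vᴮ ℤ.+ iᴮ) ℤ.+ dᴮ) ℤ.- ((eᴮ ℤ.+ + 0) ℤ.+ (fᴮ ℤ.+ iᴮ))))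
        ℤ.+ ((v* ℤ.+ fᴬ ℤ.+ vᴮ) ℤ.- (f* ℤ.+ vᴬ ℤ.+ fᴮ))
    rearrange = solve-∀

closed⁻ : ∀ H {A} → T (closed H A) → (∀ v → A (Gehm.b H v) ≡ A v) × (∀ v → A (Gehm.r H v) ≡ A v)
closed⁻ H {A} t =
  (λ v → sym (T-does⁻ (A v Bool.≟ A (b v)) (T-∧⁻ˡ (T-allFin⁻ t v)))) ,
  (λ v → sym (T-does⁻ (A v Bool.≟ A (r v)) (T-∧⁻ʳ {does (A v Bool.≟ A (b v))} (T-allFin⁻ t v))))
  where open Gehm H

closed⁺ : ∀ H {A} → (∀ v → A (Gehm.b H v) ≡ A v) → (∀ v → A (Gehm.r H v) ≡ A v) → T (closed H A)
closed⁺ H {A} A-b A-r = T-allFin⁺ λ v →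
  T-∧⁺ (T-does⁺ (A v Bool.≟ A (b v)) (sym (A-b v))) (T-does⁺ (A v Bool.≟ A (r v)) (sym (A-r v)))
  where open Gehm H

closed-dual-complement : ∀ H {A B} → (∀ x → B x ≡ not (A x)) → closed (dual H) A ≡ closed H B
closed-dual-complement H {A} {B} B≗¬A = T-injective
  (λ t → let A-r , A-b = closed⁻ (dual H) t in
    closed⁺ H (complement-invariant B≗¬A A-b) (complement-invariant B≗¬A A-r))
  (λ t → let B-b , B-r = closed⁻ H t in
    closed⁺ (dual H) (complement-invariant A≗¬B B-r) (complement-invariant A≗¬B B-b))
  where
  A≗¬B : ∀ x → A x ≡ not (B x)
  A≗¬B = complement-sym B≗¬A

cycle-balance : ∀ {v* f* vᴬ fᴬ vᴮ fᴮ X Y m} → v* ≡ vᴬ + X → f* ≡ vᴮ + Y → m ≡ fᴬ + X → m ≡ fᴮ + Y →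
                v* + fᴬ + vᴮ ≡ f* + vᴬ + fᴮ
cycle-balance {vᴬ = vᴬ} {fᴬ} {vᴮ} {fᴮ} {X} {Y} refl refl m≡fᴬ+X m≡fᴮ+Y = begin
  vᴬ + X + fᴬ + vᴮ     ≡⟨ shuffle vᴬ X fᴬ vᴮ ⟩
  (fᴬ + X) + (vᴬ + vᴮ) ≡⟨ cong (_+ (vᴬ + vᴮ)) (trans (sym m≡fᴬ+X) m≡fᴮ+Y) ⟩
  (fᴮ + Y) + (vᴬ + vᴮ) ≡⟨ shuffle′ vᴮ Y vᴬ fᴮ ⟨
  vᴮ + Y + vᴬ + fᴮ     ∎
  where
  open ≡-Reasoning
  shuffle : ∀ vᴬ X fᴬ vᴮ → vᴬ + X + fᴬ + vᴮ ≡ (fᴬ + X) + (vᴬ + vᴮ)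
  shuffle = ℕ-solve-∀
  shuffle′ : ∀ vᴮ Y vᴬ fᴮ → vᴮ + Y + vᴬ + fᴮ ≡ (fᴮ + Y) + (vᴬ + vᴮ)
  shuffle′ = ℕ-solve-∀

module Complementary (H : Gehm) {A B : Fin (Gehm.n H) → Bool}
                     (B≗¬A : ∀ x → B x ≡ not (A x)) (B-closed : T (closed H B)) where
  open Gehm H renaming (n to N)

  A≗¬B : ∀ x → A x ≡ not (B x)
  A≗¬B = complement-sym B≗¬A

  B-b : ∀ x → B (b x) ≡ B x
  B-b = proj₁ (closed⁻ H B-closed)

  B-r : ∀ x → B (r x) ≡ B x
  B-r = proj₂ (closed⁻ H B-closed)

  A-b : ∀ x → A (b x) ≡ A x
  A-b = complement-invariant A≗¬B B-b

  A-r : ∀ x → A (r x) ≡ A x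
  A-r = complement-invariant A≗¬B B-r

  mixed : Fin N → Fin N
  mixed u = if A u then r u else b u

  mixed-on-A : ∀ x → T (A x) → mixed x ≡ r x
  mixed-on-A x ax rewrite T⇒≡true ax = refl

  mixed-on-B : ∀ x → T (B x) → mixed x ≡ b x
  mixed-on-B x bx rewrite trans (A≗¬B x) (cong not (T⇒≡true bx)) = refl

  A-mixed : ∀ x → A (mixed x) ≡ A x
  A-mixed x with T? (A x)
  ... | yes ax = trans (cong A (mixed-on-A x ax)) (A-r x)
  ... | no ¬ax = trans (cong A (mixed-on-B x (complement⁺ B≗¬A ¬ax))) (A-b x)

  B-mixed : ∀ x → B (mixed x) ≡ B x
  B-mixed = complement-invariant B≗¬A A-mixed

  mixed-invol : Involution mixed
  mixed-invol x with T? (A x)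
  ... | yes ax = trans (mixed-on-A (mixed x) (subst T (sym (A-mixed x)) ax))
                       (trans (cong r (mixed-on-A x ax)) (r-invol x))
  ... | no ¬ax = trans (mixed-on-B (mixed x) (subst T (sym (B-mixed x)) (complement⁺ B≗¬A ¬ax)))
                       (trans (cong b (mixed-on-B x (complement⁺ B≗¬A ¬ax))) (b-invol x))

  gᴬ gᴮ : Fin N → Fin N
  gᴬ = gA (dual H) A
  gᴮ = gA H B

  v* f* e* vᴬ fᴬ eᴬ vᴮ fᴮ eᴮ mixed-cycles mixed-within-A mixed-within-B : ℕ
  v* = classes (λ _ → true) (g ∷ b ∷ [])
  f* = classes (λ _ → true) (r ∷ g ∷ [])
  e* = classes (λ _ → true) (r ∷ b ∷ [])
  vᴬ = classes A (gᴬ ∷ b ∷ [])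
  fᴬ = classes A (r ∷ gᴬ ∷ [])
  eᴬ = classes A (r ∷ b ∷ [])
  vᴮ = classes B (gᴮ ∷ r ∷ [])
  fᴮ = classes B (b ∷ gᴮ ∷ [])
  eᴮ = classes B (b ∷ r ∷ [])
  mixed-cycles   = classes (λ _ → true) (g ∷ mixed ∷ [])
  mixed-within-A = card (isClassMinWithin (connected (g ∷ mixed ∷ [])) A)
  mixed-within-B = card (isClassMinWithin (connected (g ∷ mixed ∷ [])) B)

  module ContractA₁ = Contraction {g = g} {φ = b} {ψ = b} {φ′ = b} {S = A}
    g-invol b-invol A-b (λ _ _ → refl) (λ _ _ → refl)
    (exitA (dual H) A) (λ _ → refl) (λ _ _ → refl)
  module ContractA₂ = Contraction {g = g} {φ = mixed} {ψ = b} {φ′ = r} {S = A}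
    g-invol mixed-invol A-mixed
    (λ x ¬ax → sym (mixed-on-B x (complement⁺ B≗¬A ¬ax))) (λ x ax → sym (mixed-on-A x ax))
    (exitA (dual H) A) (λ _ → refl) (λ _ _ → refl)
  module ContractB₁ = Contraction {g = g} {φ = r} {ψ = r} {φ′ = r} {S = B}
    g-invol r-invol B-r (λ _ _ → refl) (λ _ _ → refl)
    (exitA H B) (λ _ → refl) (λ _ _ → refl)
  module ContractB₂ = Contraction {g = g} {φ = mixed} {ψ = r} {φ′ = b} {S = B}
    g-invol mixed-invol B-mixed
    (λ x ¬bx → sym (mixed-on-A x (complement⁺ A≗¬B ¬bx))) (λ x bx → sym (mixed-on-B x bx))
    (exitA H B) (λ _ → refl) (λ _ _ → refl)

  hypervertices-dual : v* ≡ vᴬ + mixed-within-B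
  hypervertices-dual = trans (classes-split-bicoloured g-invol b-invol B≗¬A) (cong₂ _+_
    (card-classMin-cong A λ v w av aw → sym (ContractA₁.contraction av aw))
    (card-classMinWithin-agree λ x bx → sym (mixed-on-B x bx)))

  hyperfaces-dual : f* ≡ vᴮ + mixed-within-A
  hyperfaces-dual = begin
    f*
      ≡⟨ card-classMin-cong (λ _ → true) (λ v w _ _ → connected-swap r g v w) ⟩
    classes (λ _ → true) (g ∷ r ∷ [])
      ≡⟨ classes-split-bicoloured g-invol r-invol A≗¬B ⟩
    classes B (g ∷ r ∷ []) + card (isClassMinWithin (connected (g ∷ r ∷ [])) A)
      ≡⟨ cong₂ _+_ (card-classMin-cong B λ v w bv bw → sym (ContractB₁.contraction bv bw))
                   (card-classMinWithin-agree λ x ax → sym (mixed-on-A x ax)) ⟩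
    vᴮ + mixed-within-A
      ∎
    where open ≡-Reasoning

  mixed-cycles-via-A : mixed-cycles ≡ fᴬ + mixed-within-B
  mixed-cycles-via-A = trans (classes-split-bicoloured g-invol mixed-invol B≗¬A) (cong (_+ mixed-within-B)
    (card-classMin-cong A λ v w av aw → sym (trans (connected-swap r gᴬ v w) (ContractA₂.contraction av aw))))

  mixed-cycles-via-B : mixed-cycles ≡ fᴮ + mixed-within-A
  mixed-cycles-via-B = trans (classes-split-bicoloured g-invol mixed-invol A≗¬B) (cong (_+ mixed-within-A)
    (card-classMin-cong B λ v w bv bw → sym (trans (connected-swap b gᴮ v w) (ContractB₂.contraction bv bw))))

  hyperedges-split : e* ≡ eᴬ + eᴮ
  hyperedges-split = trans (classes-split-bicoloured r-invol b-invol B≗¬A) (cong (eᴬ +_) (trans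
    (card-classMinWithin-closed (B-r ∷ B-b ∷ []))
    (card-classMin-cong B λ v w _ _ → connected-swap r b v w)))

  halves-split : ⌊ count (λ _ → true) (allFin N) /2⌋ ≡ ⌊ card A /2⌋ + ⌊ card B /2⌋
  halves-split = ⌊n/2⌋-split b b-invol b-fpf A-b B≗¬A

  exponent-duality : expX2 (dual H) A ≡ expY2 H B
  exponent-duality = begin
    expX2 (dual H) A
      ≡⟨ cong₂ ℤ._-_ (twoρQ≡twiceρ (full (dual H))) (twoρQ≡twiceρ (restrict (dual H) A)) ⟩
    _ ≡⟨ exponent-identity (+ v*) (+ f*) (+ e*) (+ vᴬ) (+ fᴬ) (+ eᴬ) (+ vᴮ) (+ fᴮ) (+ eᴮ)
           (+ ⌊ count (λ _ → true) (allFin N) /2⌋) (+ ⌊ card A /2⌋) (+ ⌊ card B /2⌋)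
           (+ isolates) (+ (isolates + newIsolates (dual H) A)) (+ (isolates + newIsolates H B))
           (cong +_ hyperedges-split) (cong +_ halves-split)
           (cong +_ (cycle-balance hypervertices-dual hyperfaces-dual mixed-cycles-via-A mixed-cycles-via-B)) ⟩
    _ ≡⟨ cong₂ ℤ._-_ (cong₂ ℤ._-_ (ZP.pos-* 2 ⌊ card B /2⌋) (ZP.pos-* 2 eᴮ)) (twoρQ≡twiceρ (restrict H B)) ⟨
    expY2 H B ∎
    where
    open ≡-Reasoning
    open import Data.Integer using (+_)

-- The second exponent comes from the instance at dual H, whose dual is H up to record η.
term-duality : ∀ H {A B} → (∀ x → B x ≡ not (A x)) → ∀ i j →
  (closed (dual H) A ∧ does (expX2 (dual H) A ℤ.≟ i) ∧ does (expY2 (dual H) A ℤ.≟ j))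
  ≡ (closed H B ∧ does (expX2 H B ℤ.≟ j) ∧ does (expY2 H B ℤ.≟ i))
term-duality H {A} {B} B≗¬A i j with T? (closed H B)
... | no ¬closed-B rewrite closed-dual-complement H B≗¬A | ¬T⇒≡false ¬closed-B = refl
... | yes closed-B = cong₂ _∧_ (closed-dual-complement H B≗¬A) (begin
  does (expX2 (dual H) A ℤ.≟ i) ∧ does (expY2 (dual H) A ℤ.≟ j)
    ≡⟨ cong₂ (λ x y → does (x ℤ.≟ i) ∧ does (y ℤ.≟ j))
             (Complementary.exponent-duality H B≗¬A closed-B)
             (sym (Complementary.exponent-duality (dual H) (complement-sym B≗¬A) closed-dual-A)) ⟩
  does (expY2 H B ℤ.≟ i) ∧ does (expX2 H B ℤ.≟ j)
    ≡⟨ ∧-comm (does (expY2 H B ℤ.≟ i)) (does (expX2 H B ℤ.≟ j)) ⟩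
  does (expX2 H B ℤ.≟ j) ∧ does (expY2 H B ℤ.≟ i) ∎)
  where
  open ≡-Reasoning
  closed-dual-A : T (closed (dual H) A)
  closed-dual-A = subst T (sym (closed-dual-complement H B≗¬A)) closed-B

proposition5 : (H : Gehm) (i j : ℤ) → tutteCoeff (dual H) i j ≡ tutteCoeff H j i
proposition5 H i j = count-allSubsets-complement (Gehm.n H) _ _ λ A B B≗¬A → term-duality H B≗¬A i j
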